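{- Let $P \in \mathcal{P}$ and suppose $P \to \sigma$ for some rate distribution $\sigma$. Then for every rate distribution $\sigma'$, $P \to \sigma'$ implies $\sigma = \sigma'$.
   Context: Let $\mathcal{X}$ be a set of channel names $x,y,z,w,\dots$ and let $\lambda$ range over $\mathbb{R}^+$ (rates). Terms of $\mathcal{P}$ are generated by $P ::= M \mid P \,|\, P' \mid (\nu x)P \mid A(x_1,\dots,x_n)$, $M ::= \mathbf{0} \mid \alpha.P \mid M + M'$, $\alpha ::= \overline{x}\langle y\rangle \mid x(y) \mid \tau \mid (\lambda)$, where constants are given by a fixed set of definitions $A(\tilde{x}) \stackrel{def}{=} P$ which are weakly guarded: starting from the defining term and performing finitely many successive substitutions of constants by their defining terms, one reaches a term in which every constant occurs in the scope of a prefix. Let $\mathcal{QN}$ be a set of stochastic names $q,q',\dots$ disjoint from $\mathcal{X}$, and let $\theta$ range over $\mathcal{X}\cup\mathcal{QN}$. The extended set $\mathcal{P}_{ext}$ is generated by the same grammar with, additionally, terms $(\nu q \rightarrow \lambda)P$ (a stochastic binder binding $q$ and assigning it rate $\lambda$) and prefixes $\alpha ::= (q)$. One writes $(\nu x \rightarrow \varepsilon)$ for $(\nu x)$, and $(\nu \theta \rightarrow \hat\lambda)$ for an arbitrary binder with $\hat\lambda \in \mathbb{R}^+\cup\{\varepsilon\}$. Structural congruence $\equiv$ on $\mathcal{P}_{ext}$ is the smallest congruence including alpha-renaming of bound names and the laws: $(\nu\theta\rightarrow\hat\lambda)P \,|\, Q \equiv (\nu\theta\rightarrow\hat\lambda)(P\,|\,Q)$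 if $\theta\notin fn(Q)$; $(\nu\theta\rightarrow\hat\lambda)(\nu\theta'\rightarrow\hat\lambda')P \equiv (\nu\theta'\rightarrow\hat\lambda')(\nu\theta\rightarrow\hat\lambda)P$ if $\theta\neq\theta'$; $(\nu\theta\rightarrow\hat\lambda)\mathbf{0}\equiv\mathbf{0}$; $(M_1+M_2)+M_3 \equiv M_1+(M_2+M_3)$; $M+N\equiv N+M$; $M+\mathbf{0}\equiv M$; $(P_1|P_2)|P_3\equiv P_1|(P_2|P_3)$; $P|Q\equiv Q|P$; $P|\mathbf{0}\equiv P$; $A(\tilde y)\equiv P\{\tilde y/\tilde x\}$ if $A(\tilde x)\stackrel{def}{=}P$; and $(\lambda).P + M \equiv (\nu q\rightarrow\lambda)((q).P+M)$ if $q\notin fn(M,P)$. Transitions $P \xrightarrow{\hat q} P'$ with $\hat q \in \mathcal{QN}\cup\{\varepsilon\}$ (an $\varepsilon$-label is written $P\to P'$) are the smallest relation on $\mathcal{P}_{ext}$ closed under: $(q).P+M \xrightarrow{q} P$; $\tau.P+M \to P$; $x(z).P+M \,|\, \overline{x}\langle y\rangle.Q+N \to P\{y/z\}\,|\,Q$; if $P\xrightarrow{\hat q}P'$ then $P|Q\xrightarrow{\hat q}P'|Q$; if $P\xrightarrow{\hat q}P'$ and $\theta\neq\hat q$ then $(\nu\theta\rightarrow\hat\lambda)P \xrightarrow{\hat q} (\nu\theta\rightarrow\hat\lambda)P'$; if $P\equiv Q$, $Q\xrightarrow{\hat q}Q'$, $Q'\equiv P'$ then $P\xrightarrow{\hat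 q}P'$. A rate distribution is a non-empty finite multiset of pairs $(\lambda, e)$ with $\lambda\in\mathbb{R}^+$ and $e \in \mathcal{P}_{ext}/\!\equiv$. For a rate distribution $\sigma$, $(\nu q\rightarrow\lambda)\sigma$ denotes the multiset $\{\!|\,(\lambda',[(\nu q\rightarrow\lambda)P]_\equiv) \mid (\lambda',[P]_\equiv)\in\sigma\,|\!\}$; $\cup$ is multiset union. Stochastic transitions $P\to\sigma$ (from a term to a rate distribution) are the least relation (well-defined by stratification despite the negative premise) closed under: (Sto1) if $P\to\sigma$ and $P\xrightarrow{q}P'$ then $(\nu q\rightarrow\lambda)P \to (\nu q\rightarrow\lambda)\sigma \cup \{\!|(\lambda,[(\nu q\rightarrow\lambda)P']_\equiv)|\!\}$; (Sto2) if there is no $\sigma$ with $P\to\sigma$, and $P\xrightarrow{q}P'$, then $(\nu q\rightarrow\lambda)P\to\{\!|(\lambda,[(\nu q\rightarrow\lambda)P']_\equiv)|\!\}$; (StoCong) if $P\equiv Q$ and $Q\to\sigma$ then $P\to\sigma$. -}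

module Defs where

open import Data.Nat using (ℕ; zero; suc; _<_)
open import Data.Nat.Properties using (_<?_)
open import Data.Fin using (fromℕ<)
open import Data.Vec using (Vec; lookup)
import Data.Vec as Vec
open import Data.Vec.Relation.Unary.All using (All)
open import Data.Maybe using (Maybe; just; nothing)
open import Data.Product using (Σ; _×_; _,_)
open import Data.Unit using (⊤)
open import Data.Empty using (⊥)
open import Data.List.NonEmpty using (List⁺; [_]; _∷⁺_; toList)
import Data.List.NonEmpty as List⁺
import Data.List.Relation.Binary.Permutation.Homogeneous as Perm
open import Relation.Binary.PropositionalEquality using (_≡_)
open import Relation.Binary.Construct.Closure.ReflexiveTransitive using (Star)
open import Relation.Nullary using (¬_; yes; no)

-- Syntax of P_ext, with two-sorted de Bruijn indices:
--   * channel names (the set X) are natural numbers, bound by (ν x) and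
--     by the input prefix x(y);
--   * stochastic names (the set QN) are natural numbers in a SEPARATE
--     index space, bound by (ν q → λ).

module Syntax (Rate : Set) (Const : Set) (arity : Const → ℕ) where

  mutual
    data Proc : Set where
      sum  : Sum → Proc
      _∣_  : Proc → Proc → Proc
      ν_   : Proc → Proc
      νq   : Rate → Proc → Proc
      call : (A : Const) → Vec ℕ (arity A) → Proc

    data Sum : Set where
      𝟘    : Sum
      out  : ℕ → ℕ → Proc → Sum
      inp  : ℕ → Proc → Sum             -- x(y).P   (binds channel 0 in P)
      tau  : Proc → Sum
      rate : Rate → Proc → Sum
      sto  : ℕ → Proc → Sum
      _⊕_  : Sum → Sum → Sum

  infixr 6 _⊕_
  infixr 5 _∣_

  lift : (ℕ → ℕ) → ℕ → ℕ
  lift ρ zero    = zero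
  lift ρ (suc i) = suc (ρ i)

  mutual
    renC : (ℕ → ℕ) → Proc → Proc
    renC ρ (sum M)     = sum (renCS ρ M)
    renC ρ (P ∣ Q)     = renC ρ P ∣ renC ρ Q
    renC ρ (ν P)       = ν (renC (lift ρ) P)
    renC ρ (νq r P)    = νq r (renC ρ P)
    renC ρ (call A ys) = call A (Vec.map ρ ys)

    renCS : (ℕ → ℕ) → Sum → Sum
    renCS ρ 𝟘           = 𝟘
    renCS ρ (out x y P) = out (ρ x) (ρ y) (renC ρ P)
    renCS ρ (inp x P)   = inp (ρ x) (renC (lift ρ) P)
    renCS ρ (tau P)     = tau (renC ρ P)
    renCS ρ (rate r P)  = rate r (renC ρ P)
    renCS ρ (sto q P)   = sto q (renC ρ P)
    renCS ρ (M ⊕ N)     = renCS ρ M ⊕ renCS ρ N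

  mutual
    renQ : (ℕ → ℕ) → Proc → Proc
    renQ ρ (sum M)     = sum (renQS ρ M)
    renQ ρ (P ∣ Q)     = renQ ρ P ∣ renQ ρ Q
    renQ ρ (ν P)       = ν (renQ ρ P)
    renQ ρ (νq r P)    = νq r (renQ (lift ρ) P)
    renQ ρ (call A ys) = call A ys

    renQS : (ℕ → ℕ) → Sum → Sum
    renQS ρ 𝟘           = 𝟘
    renQS ρ (out x y P) = out x y (renQ ρ P)
    renQS ρ (inp x P)   = inp x (renQ ρ P)
    renQS ρ (tau P)     = tau (renQ ρ P)
    renQS ρ (rate r P)  = rate r (renQ ρ P)
    renQS ρ (sto q P)   = sto (ρ q) (renQ ρ P)
    renQS ρ (M ⊕ N)     = renQS ρ M ⊕ renQS ρ N

  swap01 : ℕ → ℕ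
  swap01 zero          = suc zero
  swap01 (suc zero)    = zero
  swap01 (suc (suc n)) = suc (suc n)

  subst0 : ℕ → ℕ → ℕ
  subst0 y zero    = y
  subst0 y (suc i) = i

  substArgs : ∀ {n} → Vec ℕ n → ℕ → ℕ
  substArgs {n} ys i with i <? n
  ... | yes i<n = lookup ys (fromℕ< i<n)
  ... | no  _   = i

  -- membership in the sublanguage P (no stochastic names or binders)
  mutual
    InP : Proc → Set
    InP (sum M)     = InPS M
    InP (P ∣ Q)     = InP P × InP Q
    InP (ν P)       = InP P
    InP (νq r P)    = ⊥
    InP (call A ys) = ⊤

    InPS : Sum → Set
    InPS 𝟘           = ⊤
    InPS (out x y P) = InP P
    InPS (inp x P)   = InP P
    InPS (tau P)     = InP P
    InPS (rate r P)  = InP P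
    InPS (sto q P)   = ⊥
    InPS (M ⊕ N)     = InPS M × InPS N

  mutual
    ChanFV< : ℕ → Proc → Set
    ChanFV< n (sum M)     = ChanFVS< n M
    ChanFV< n (P ∣ Q)     = ChanFV< n P × ChanFV< n Q
    ChanFV< n (ν P)       = ChanFV< (suc n) P
    ChanFV< n (νq r P)    = ChanFV< n P
    ChanFV< n (call A ys) = All (_< n) ys

    ChanFVS< : ℕ → Sum → Set
    ChanFVS< n 𝟘           = ⊤
    ChanFVS< n (out x y P) = (x < n) × (y < n) × ChanFV< n P
    ChanFVS< n (inp x P)   = (x < n) × ChanFV< (suc n) P
    ChanFVS< n (tau P)     = ChanFV< n P
    ChanFVS< n (rate r P)  = ChanFV< n P
    ChanFVS< n (sto q P)   = ChanFV< n P
    ChanFVS< n (M ⊕ N)     = ChanFVS< n M × ChanFVS< n N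

  -- every constant occurs in the scope of a prefix
  -- (everything inside a sum is under a prefix)
  Guarded : Proc → Set
  Guarded (sum M)     = ⊤
  Guarded (P ∣ Q)     = Guarded P × Guarded Q
  Guarded (ν P)       = Guarded P
  Guarded (νq r P)    = Guarded P
  Guarded (call A ys) = ⊥

-- Semantics, relative to a fixed set of definitions  A(x̃) =def body A
-- (body A uses channel indices 0 … arity A - 1 for the parameters x̃).

module Semantics (Rate : Set) (Const : Set) (arity : Const → ℕ)
                 (body : Const → Syntax.Proc Rate Const arity) where

  open Syntax Rate Const arity public

  inst : (A : Const) → Vec ℕ (arity A) → Proc
  inst A ys = renC (substArgs ys) (body A)

  mutual
    data Unfold : Proc → Proc → Set where
      u-here : ∀ {A ys} → Unfold (call A ys) (inst A ys)
      u-sum  : ∀ {M M'} → UnfoldS M M' → Unfold (sum M) (sum M')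
      u-parˡ : ∀ {P P' Q} → Unfold P P' → Unfold (P ∣ Q) (P' ∣ Q)
      u-parʳ : ∀ {P Q Q'} → Unfold Q Q' → Unfold (P ∣ Q) (P ∣ Q')
      u-ν    : ∀ {P P'} → Unfold P P' → Unfold (ν P) (ν P')
      u-νq   : ∀ {r P P'} → Unfold P P' → Unfold (νq r P) (νq r P')

    data UnfoldS : Sum → Sum → Set where
      u-out  : ∀ {x y P P'} → Unfold P P' → UnfoldS (out x y P) (out x y P')
      u-inp  : ∀ {x P P'} → Unfold P P' → UnfoldS (inp x P) (inp x P')
      u-tau  : ∀ {P P'} → Unfold P P' → UnfoldS (tau P) (tau P')
      u-rate : ∀ {r P P'} → Unfold P P' → UnfoldS (rate r P) (rate r P')
      u-sto  : ∀ {q P P'} → Unfold P P' → UnfoldS (sto q P) (sto q P')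
      u-⊕ˡ   : ∀ {M M' N} → UnfoldS M M' → UnfoldS (M ⊕ N) (M' ⊕ N)
      u-⊕ʳ   : ∀ {M N N'} → UnfoldS N N' → UnfoldS (M ⊕ N) (M ⊕ N')

  WeaklyGuarded : Const → Set
  WeaklyGuarded A = Σ Proc λ T → Star Unfold (body A) T × Guarded T

  WellFormedDefs : Set
  WellFormedDefs = ∀ A → InP (body A) × ChanFV< (arity A) (body A) × WeaklyGuarded A

  infix 4 _≈P_ _≈S_
  mutual
    data _≈P_ : Proc → Proc → Set where
      reflP   : ∀ {P} → P ≈P P
      symP    : ∀ {P Q} → P ≈P Q → Q ≈P P
      transP  : ∀ {P Q R} → P ≈P Q → Q ≈P R → P ≈P R
      c-sum   : ∀ {M M'} → M ≈S M' → sum M ≈P sum M'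
      c-par   : ∀ {P P' Q Q'} → P ≈P P' → Q ≈P Q' → (P ∣ Q) ≈P (P' ∣ Q')
      c-ν     : ∀ {P P'} → P ≈P P' → ν P ≈P ν P'
      c-νq    : ∀ {r P P'} → P ≈P P' → νq r P ≈P νq r P'
      -- scope extrusion (θ ∉ fn(Q) is realised by shifting Q)
      extr-ν  : ∀ {P Q} → ((ν P) ∣ Q) ≈P ν (P ∣ renC suc Q)
      extr-νq : ∀ {r P Q} → (νq r P ∣ Q) ≈P νq r (P ∣ renQ suc Q)
      sw-νν   : ∀ {P} → ν (ν P) ≈P ν (ν (renC swap01 P))
      sw-ννq  : ∀ {r P} → ν (νq r P) ≈P νq r (ν P)
      sw-νqνq : ∀ {r r' P} → νq r (νq r' P) ≈P νq r' (νq r (renQ swap01 P))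
      ν-𝟘     : ν (sum 𝟘) ≈P sum 𝟘
      νq-𝟘    : ∀ {r} → νq r (sum 𝟘) ≈P sum 𝟘
      par-assoc : ∀ {P Q R} → ((P ∣ Q) ∣ R) ≈P (P ∣ (Q ∣ R))
      par-comm  : ∀ {P Q} → (P ∣ Q) ≈P (Q ∣ P)
      par-𝟘     : ∀ {P} → (P ∣ sum 𝟘) ≈P P
      unfold  : ∀ {A ys} → call A ys ≈P inst A ys
      -- (λ).P + M ≡ (ν q → λ)((q).P + M),  q ∉ fn(M,P)
      rate-ν  : ∀ {r P M} →
        sum (rate r P ⊕ M) ≈P νq r (sum (sto zero (renQ suc P) ⊕ renQS suc M))

    data _≈S_ : Sum → Sum → Set where
      reflS   : ∀ {M} → M ≈S M
      symS    : ∀ {M N} → M ≈S N → N ≈S M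
      transS  : ∀ {M N O} → M ≈S N → N ≈S O → M ≈S O
      c-out   : ∀ {x y P P'} → P ≈P P' → out x y P ≈S out x y P'
      c-inp   : ∀ {x P P'} → P ≈P P' → inp x P ≈S inp x P'
      c-tau   : ∀ {P P'} → P ≈P P' → tau P ≈S tau P'
      c-rate  : ∀ {r P P'} → P ≈P P' → rate r P ≈S rate r P'
      c-sto   : ∀ {q P P'} → P ≈P P' → sto q P ≈S sto q P'
      c-⊕     : ∀ {M M' N N'} → M ≈S M' → N ≈S N' → (M ⊕ N) ≈S (M' ⊕ N')
      sum-assoc : ∀ {M₁ M₂ M₃} → ((M₁ ⊕ M₂) ⊕ M₃) ≈S (M₁ ⊕ (M₂ ⊕ M₃))
      sum-comm  : ∀ {M N} → (M ⊕ N) ≈S (N ⊕ M)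
      sum-𝟘     : ∀ {M} → (M ⊕ 𝟘) ≈S M

  -- labelled transitions  P --q̂--> P' ;  nothing = ε,  just q = q
  infix 4 _─[_]→_
  data _─[_]→_ : Proc → Maybe ℕ → Proc → Set where
    t-sto  : ∀ {q P M} → sum (sto q P ⊕ M) ─[ just q ]→ P
    t-tau  : ∀ {P M} → sum (tau P ⊕ M) ─[ nothing ]→ P
    t-com  : ∀ {x y P Q M N} →
      (sum (inp x P ⊕ M) ∣ sum (out x y Q ⊕ N)) ─[ nothing ]→ (renC (subst0 y) P ∣ Q)
    t-par  : ∀ {l P P' Q} → P ─[ l ]→ P' → (P ∣ Q) ─[ l ]→ (P' ∣ Q)
    -- restriction of a channel: labels are stochastic names, so θ ≠ q̂
    t-ν    : ∀ {l P P'} → P ─[ l ]→ P' → ν P ─[ l ]→ ν P'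
    -- restriction of a stochastic name (bound name = index 0 ≠ q̂)
    t-νqε  : ∀ {r P P'} → P ─[ nothing ]→ P' → νq r P ─[ nothing ]→ νq r P'
    t-νq   : ∀ {r k P P'} → P ─[ just (suc k) ]→ P' → νq r P ─[ just k ]→ νq r P'
    t-cong : ∀ {l P Q Q' P'} → P ≈P Q → Q ─[ l ]→ Q' → Q' ≈P P' → P ─[ l ]→ P'

  -- rate distributions: non-empty finite multisets of pairs (λ, e),
  -- e a ≡-class, represented by a non-empty list of representatives
  Dist : Set
  Dist = List⁺ (Rate × Proc)

  νqD : Rate → Dist → Dist
  νqD r σ = List⁺.map (λ { (r' , P) → (r' , νq r P) }) σ

  _≈E_ : Rate × Proc → Rate × Proc → Set
  (r , P) ≈E (r' , P') = (r ≡ r') × (P ≈P P')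

  infix 4 _≈D_
  _≈D_ : Dist → Dist → Set
  σ ≈D σ' = Perm.Permutation _≈E_ (toList σ) (toList σ')

  -- stochastic transitions, relative to a predicate N that is used to
  -- interpret the negative premise "there is no σ with P → σ"
  module Stochastic (N : Proc → Set) where
    infix 4 _⟹_
    data _⟹_ : Proc → Dist → Set where
      sto1    : ∀ {r P P' σ} → P ⟹ σ → P ─[ just zero ]→ P' →
                νq r P ⟹ ((r , νq r P') ∷⁺ νqD r σ)
      sto2    : ∀ {r P P'} → ¬ N P → P ─[ just zero ]→ P' →
                νq r P ⟹ [ (r , νq r P') ]
      stoCong : ∀ {P Q σ} → P ≈P Q → Q ⟹ σ → P ⟹ σ

  -- N correctly interprets the negative premise: N P holds exactly when
  -- there is some σ with P → σ (relation defined using N itself)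
  StratifiedNeg : (Proc → Set) → Set
  StratifiedNeg N = ∀ P → (N P → Σ Dist (λ σ → P ⟹ σ)) × (Σ Dist (λ σ → P ⟹ σ) → N P)
    where open Stochastic N

-- To every term one associates, independently of the stochastic rules, the list of entries a
-- derivation of P → σ can produce: an entry (λ, P′) for each rate prefix (λ).P′ (a binder in disguise,
-- by the last law of ≡) and, for each binder (ν q → λ), an entry per residual of an unguarded
-- (q)-prefix, wrapped in the binder.  This list is invariant under ≡ up to reordering and ≡ of
-- residuals.  In any term ≡ to a term of 𝒫 each binder has at most one unguarded occurrence of its
-- name, and this linearity is again invariant under ≡.  For linear terms, induction on P → σ shows
-- that σ is exactly that list: Sto1 and Sto2 contribute the single residual of the outermost binder,
-- StoCong is covered by invariance, and the negative premise of Sto2 holds exactly when the body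
-- contributes nothing, since a nonempty list exhibits, up to ≡, a binder whose name fires, from
-- which a stochastic transition is built by induction on the length of the list.

module Submission where

open import Defs
open import Data.Empty using (⊥-elim)
open import Data.Fin using (fromℕ<)
open import Data.List using (List; []; _∷_; _++_; map; length)
open import Data.List.Membership.Propositional using (_∈_)
open import Data.List.Membership.Propositional.Properties using (∈-++⁻; ∈-map⁺; ∈-map⁻)
open import Data.List.NonEmpty using (toList)
open import Data.List.Properties
  using (map-++; map-∘; map-id; length-map; length-++-≤ʳ; ++-assoc; ++-identityʳ)
import Data.List.Relation.Binary.Permutation.Setoid as Permutation
import Data.List.Relation.Binary.Permutation.Setoid.Properties as PermutationProperties
open import Data.List.Relation.Unary.Any using (Any; here; there)
import Data.List.Relation.Unary.Any as Any
open import Data.List.Relation.Unary.Any.Properties using (++⁺ˡ)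
open import Data.Maybe using (just)
open import Data.Nat using (ℕ; zero; suc; _<_; _≤_; z≤n; s≤s)
open import Data.Nat.Properties using (_≟_; _<?_; suc-injective; ≤-refl; <-≤-trans)
open import Data.Product using (∃; ∃₂; _×_; _,_; proj₁; proj₂; map₂)
open import Data.Product.Function.NonDependent.Propositional using (_×-⇔_)
open import Data.Sum using (inj₁; inj₂)
open import Data.Unit using (⊤; tt)
open import Data.Vec using (Vec)
import Data.Vec as Vec
open import Data.Vec.Properties using (lookup-map)
open import Data.Vec.Relation.Unary.All using (All; []; _∷_)
open import Function using (_∘_; id; Injective; _⇔_; mk⇔; Equivalence)
open import Function.Construct.Composition using (_⇔-∘_)
open import Function.Construct.Identity using (⇔-id)
open import Function.Construct.Symmetry using (⇔-sym)
open import Relation.Binary.Bundles using (Setoid)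
open import Relation.Binary.Construct.Closure.ReflexiveTransitive using (Star; ε; _◅_)
open import Relation.Binary.PropositionalEquality
  using (_≡_; _≢_; refl; sym; trans; cong; cong₂; subst)
import Relation.Binary.Reasoning.Setoid as ≈-Reasoning
open import Relation.Nullary using (¬_; yes; no)

length-++-suffix : ∀ {A : Set} {x : A} xs ys → x ∈ xs → length ys < length (xs ++ ys)
length-++-suffix (_ ∷ xs) ys _ = s≤s (length-++-≤ʳ ys {xs})

Any-singleton : ∀ {A : Set} {P : A → Set} {xs} → Any P xs → length xs ≤ 1 →
                ∃ λ x → xs ≡ x ∷ [] × P x
Any-singleton {xs = x ∷ []}    (here px) _  = x , refl , px
Any-singleton {xs = _ ∷ _ ∷ _} _ (s≤s ())

×-assocʳ : ∀ {A B C : Set} → ((A × B) × C) ⇔ (A × B × C)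
×-assocʳ = mk⇔ (λ ((a , b) , c) → a , b , c) (λ (a , b , c) → (a , b) , c)

×-swapˡ : ∀ {A B C : Set} → (A × B × C) ⇔ (B × A × C)
×-swapˡ = mk⇔ (λ (a , b , c) → b , a , c) (λ (b , a , c) → a , b , c)

≤1-cong : ∀ {m n} → m ≡ n → (m ≤ 1) ⇔ (n ≤ 1)
≤1-cong m≡n = mk⇔ (subst (_≤ 1) m≡n) (subst (_≤ 1) (sym m≡n))

module Uniqueness (Rate Const : Set) (arity : Const → ℕ)
                  (body : Const → Syntax.Proc Rate Const arity) where

  open Semantics Rate Const arity body

  infix 4 _≗_below_
  _≗_below_ : (ℕ → ℕ) → (ℕ → ℕ) → ℕ → Set
  f ≗ g below n = ∀ {i} → i < n → f i ≡ g i

  lift-below : ∀ {f g h : ℕ → ℕ} {n} → f ∘ g ≗ h below n →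
               lift f ∘ lift g ≗ lift h below suc n
  lift-below fg≗h {zero}  _       = refl
  lift-below fg≗h {suc i} (s≤s i<n) = cong suc (fg≗h i<n)

  map-map-below : ∀ {f g h : ℕ → ℕ} {n m} {ys : Vec ℕ m} → f ∘ g ≗ h below n → All (_< n) ys →
                  Vec.map f (Vec.map g ys) ≡ Vec.map h ys
  map-map-below fg≗h []         = refl
  map-map-below fg≗h (y<n ∷ ys) = cong₂ Vec._∷_ (fg≗h y<n) (map-map-below fg≗h ys)

  mutual
    renC-renC : ∀ {f g h : ℕ → ℕ} {n} → f ∘ g ≗ h below n → ∀ P → ChanFV< n P →
                renC f (renC g P) ≡ renC h P
    renC-renC fg≗h (sum M)     fv         = cong sum (renCS-renCS fg≗h M fv)
    renC-renC fg≗h (P ∣ Q)     (fvP , fvQ) =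
      cong₂ _∣_ (renC-renC fg≗h P fvP) (renC-renC fg≗h Q fvQ)
    renC-renC fg≗h (ν P)       fv         = cong ν_ (renC-renC (lift-below fg≗h) P fv)
    renC-renC fg≗h (νq r P)    fv         = cong (νq r) (renC-renC fg≗h P fv)
    renC-renC fg≗h (call A ys) fv         = cong (call A) (map-map-below fg≗h fv)

    renCS-renCS : ∀ {f g h : ℕ → ℕ} {n} → f ∘ g ≗ h below n → ∀ M → ChanFVS< n M →
                  renCS f (renCS g M) ≡ renCS h M
    renCS-renCS fg≗h 𝟘           _                = refl
    renCS-renCS fg≗h (out x y P) (x<n , y<n , fv)
      rewrite fg≗h x<n | fg≗h y<n = cong (out _ _) (renC-renC fg≗h P fv)
    renCS-renCS fg≗h (inp x P)   (x<n , fv)       =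
      cong₂ inp (fg≗h x<n) (renC-renC (lift-below fg≗h) P fv)
    renCS-renCS fg≗h (tau P)     fv               = cong tau (renC-renC fg≗h P fv)
    renCS-renCS fg≗h (rate r P)  fv               = cong (rate r) (renC-renC fg≗h P fv)
    renCS-renCS fg≗h (sto q P)   fv               = cong (sto q) (renC-renC fg≗h P fv)
    renCS-renCS fg≗h (M ⊕ N)     (fvM , fvN)      =
      cong₂ _⊕_ (renCS-renCS fg≗h M fvM) (renCS-renCS fg≗h N fvN)

  substArgs-map : ∀ {n} ρ (ys : Vec ℕ n) → ρ ∘ substArgs ys ≗ substArgs (Vec.map ρ ys) below n
  substArgs-map {n} ρ ys {i} i<n with i <? n
  ... | yes i<n′ = sym (lookup-map (fromℕ< i<n′) ρ ys)
  ... | no  i≮n  = ⊥-elim (i≮n i<n)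

  mutual
    renQ-InP : ∀ ρ P → InP P → renQ ρ P ≡ P
    renQ-InP ρ (sum M)     inP         = cong sum (renQS-InPS ρ M inP)
    renQ-InP ρ (P ∣ Q)     (inP , inQ) = cong₂ _∣_ (renQ-InP ρ P inP) (renQ-InP ρ Q inQ)
    renQ-InP ρ (ν P)       inP         = cong ν_ (renQ-InP ρ P inP)
    renQ-InP ρ (call A ys) _           = refl

    renQS-InPS : ∀ ρ M → InPS M → renQS ρ M ≡ M
    renQS-InPS ρ 𝟘           _           = refl
    renQS-InPS ρ (out x y P) inP         = cong (out x y) (renQ-InP ρ P inP)
    renQS-InPS ρ (inp x P)   inP         = cong (inp x) (renQ-InP ρ P inP)
    renQS-InPS ρ (tau P)     inP         = cong tau (renQ-InP ρ P inP)
    renQS-InPS ρ (rate r P)  inP         = cong (rate r) (renQ-InP ρ P inP)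
    renQS-InPS ρ (M ⊕ N)     (inM , inN) = cong₂ _⊕_ (renQS-InPS ρ M inM) (renQS-InPS ρ N inN)

  mutual
    InP-renC : ∀ ρ P → InP P → InP (renC ρ P)
    InP-renC ρ (sum M)     inP         = InPS-renCS ρ M inP
    InP-renC ρ (P ∣ Q)     (inP , inQ) = InP-renC ρ P inP , InP-renC ρ Q inQ
    InP-renC ρ (ν P)       inP         = InP-renC (lift ρ) P inP
    InP-renC ρ (call A ys) _           = tt

    InPS-renCS : ∀ ρ M → InPS M → InPS (renCS ρ M)
    InPS-renCS ρ 𝟘           _           = tt
    InPS-renCS ρ (out x y P) inP         = InP-renC ρ P inP
    InPS-renCS ρ (inp x P)   inP         = InP-renC (lift ρ) P inP
    InPS-renCS ρ (tau P)     inP         = InP-renC ρ P inP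
    InPS-renCS ρ (rate r P)  inP         = InP-renC ρ P inP
    InPS-renCS ρ (M ⊕ N)     (inM , inN) = InPS-renCS ρ M inM , InPS-renCS ρ N inN

  lift-injective : ∀ {ρ} → Injective _≡_ _≡_ ρ → Injective _≡_ _≡_ (lift ρ)
  lift-injective ρ-inj {zero}  {zero}  _  = refl
  lift-injective ρ-inj {suc i} {suc j} eq = cong suc (ρ-inj (suc-injective eq))

  swap01-involutive : ∀ i → swap01 (swap01 i) ≡ i
  swap01-involutive zero          = refl
  swap01-involutive (suc zero)    = refl
  swap01-involutive (suc (suc i)) = refl

  swap01-injective : Injective _≡_ _≡_ swap01
  swap01-injective {i} {j} eq =
    trans (sym (swap01-involutive i)) (trans (cong swap01 eq) (swap01-involutive j))

  lift-∉ : ∀ {ρ k} → (∀ j → ρ j ≢ k) → ∀ j → lift ρ j ≢ suc k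
  lift-∉ ρ∉ (suc j) eq = ρ∉ j (suc-injective eq)

  ⊕-pullˡ : ∀ {M N α M′} → M ≈S α ⊕ M′ → M ⊕ N ≈S α ⊕ (M′ ⊕ N)
  ⊕-pullˡ M≈ = transS (c-⊕ M≈ reflS) sum-assoc

  ⊕-pullʳ : ∀ {M N α N′} → N ≈S α ⊕ N′ → M ⊕ N ≈S α ⊕ (N′ ⊕ M)
  ⊕-pullʳ N≈ = transS sum-comm (⊕-pullˡ N≈)

  ≈P-setoid : Setoid _ _
  ≈P-setoid = record
    { Carrier = Proc ; _≈_ = _≈P_
    ; isEquivalence = record { refl = reflP ; sym = symP ; trans = transP } }

  νq-vacuous : ∀ {r} P → νq r (renQ suc P) ≈P P
  νq-vacuous {r} P = begin
    νq r (renQ suc P)              ≈⟨ c-νq (symP par-𝟘) ⟩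
    νq r (renQ suc P ∣ sum 𝟘)      ≈⟨ c-νq par-comm ⟩
    νq r (sum 𝟘 ∣ renQ suc P)      ≈⟨ symP extr-νq ⟩
    νq r (sum 𝟘) ∣ P               ≈⟨ c-par νq-𝟘 reflP ⟩
    sum 𝟘 ∣ P                      ≈⟨ par-comm ⟩
    P ∣ sum 𝟘                      ≈⟨ par-𝟘 ⟩
    P                              ∎
    where open ≈-Reasoning ≈P-setoid

  infix 4 _≈ᶜ_
  _≈ᶜ_ : (Proc → Proc) → (Proc → Proc) → Set
  c ≈ᶜ c′ = ∀ {X Y} → X ≈P Y → c X ≈P c′ Y

  ≈ᶜ-sym : ∀ {c c′} → c ≈ᶜ c′ → c′ ≈ᶜ c
  ≈ᶜ-sym c≈c′ X≈Y = symP (c≈c′ (symP X≈Y))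

  ≈ᶜ-reflˡ : ∀ {c c′} → c ≈ᶜ c′ → c ≈ᶜ c
  ≈ᶜ-reflˡ c≈c′ X≈Y = transP (c≈c′ X≈Y) (symP (c≈c′ reflP))

  -- Residuals of stochastic names

  -- Threading the context through makes the renaming and ≡-invariance lemmas hold clause by clause,
  -- without any map fusion.
  firesS : (Proc → Proc) → ℕ → Sum → List Proc
  firesS c k 𝟘           = []
  firesS c k (out x y P) = []
  firesS c k (inp x P)   = []
  firesS c k (tau P)     = []
  firesS c k (rate r P)  = []
  firesS c k (sto q P) with q ≟ k
  ... | yes _ = c P ∷ []
  ... | no  _ = []
  firesS c k (M ⊕ N)     = firesS c k M ++ firesS c k N

  fires : (Proc → Proc) → ℕ → Proc → List Proc
  fires c k (sum M)     = firesS c k M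
  fires c k (P ∣ Q)     = fires (λ X → c (X ∣ Q)) k P ++ fires (λ X → c (P ∣ X)) k Q
  fires c k (ν P)       = fires (c ∘ ν_) k P
  fires c k (νq r P)    = fires (c ∘ νq r) (suc k) P
  fires c k (call A ys) = []

  firesS-∘ : ∀ c d k M → firesS (c ∘ d) k M ≡ map c (firesS d k M)
  firesS-∘ c d k 𝟘           = refl
  firesS-∘ c d k (out x y P) = refl
  firesS-∘ c d k (inp x P)   = refl
  firesS-∘ c d k (tau P)     = refl
  firesS-∘ c d k (rate r P)  = refl
  firesS-∘ c d k (sto q P) with q ≟ k
  ... | yes _ = refl
  ... | no  _ = refl
  firesS-∘ c d k (M ⊕ N) =
    trans (cong₂ _++_ (firesS-∘ c d k M) (firesS-∘ c d k N)) (sym (map-++ c (firesS d k M) _))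

  fires-∘ : ∀ c d k P → fires (c ∘ d) k P ≡ map c (fires d k P)
  fires-∘ c d k (sum M)     = firesS-∘ c d k M
  fires-∘ c d k (P ∣ Q)     =
    trans (cong₂ _++_ (fires-∘ c _ k P) (fires-∘ c _ k Q)) (sym (map-++ c (fires _ k P) _))
  fires-∘ c d k (ν P)       = fires-∘ c (d ∘ ν_) k P
  fires-∘ c d k (νq r P)    = fires-∘ c (d ∘ νq r) (suc k) P
  fires-∘ c d k (call A ys) = refl

  #fires : ℕ → Proc → ℕ
  #fires k P = length (fires id k P)

  length-fires : ∀ c k P → length (fires c k P) ≡ #fires k P
  length-fires c k P = trans (cong length (fires-∘ c id k P)) (length-map c (fires id k P))

  firesS-renCS : ∀ c ρ k M → firesS c k (renCS ρ M) ≡ firesS (c ∘ renC ρ) k M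
  firesS-renCS c ρ k 𝟘           = refl
  firesS-renCS c ρ k (out x y P) = refl
  firesS-renCS c ρ k (inp x P)   = refl
  firesS-renCS c ρ k (tau P)     = refl
  firesS-renCS c ρ k (rate r P)  = refl
  firesS-renCS c ρ k (sto q P) with q ≟ k
  ... | yes _ = refl
  ... | no  _ = refl
  firesS-renCS c ρ k (M ⊕ N) = cong₂ _++_ (firesS-renCS c ρ k M) (firesS-renCS c ρ k N)

  fires-renC : ∀ c ρ k P → fires c k (renC ρ P) ≡ fires (c ∘ renC ρ) k P
  fires-renC c ρ k (sum M)     = firesS-renCS c ρ k M
  fires-renC c ρ k (P ∣ Q)     = cong₂ _++_ (fires-renC _ ρ k P) (fires-renC _ ρ k Q)
  fires-renC c ρ k (ν P)       = fires-renC (c ∘ ν_) (lift ρ) k P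
  fires-renC c ρ k (νq r P)    = fires-renC (c ∘ νq r) ρ (suc k) P
  fires-renC c ρ k (call A ys) = refl

  firesS-renQS : ∀ {ρ} → Injective _≡_ _≡_ ρ → ∀ c k M →
                 firesS c (ρ k) (renQS ρ M) ≡ firesS (c ∘ renQ ρ) k M
  firesS-renQS ρ-inj c k 𝟘           = refl
  firesS-renQS ρ-inj c k (out x y P) = refl
  firesS-renQS ρ-inj c k (inp x P)   = refl
  firesS-renQS ρ-inj c k (tau P)     = refl
  firesS-renQS ρ-inj c k (rate r P)  = refl
  firesS-renQS {ρ} ρ-inj c k (sto q P) with q ≟ k | ρ q ≟ ρ k
  ... | yes _    | yes _     = refl
  ... | no  _    | no  _     = refl
  ... | yes refl | no ρq≢ρk  = ⊥-elim (ρq≢ρk refl)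
  ... | no q≢k   | yes ρq≡ρk = ⊥-elim (q≢k (ρ-inj ρq≡ρk))
  firesS-renQS ρ-inj c k (M ⊕ N) =
    cong₂ _++_ (firesS-renQS ρ-inj c k M) (firesS-renQS ρ-inj c k N)

  fires-renQ : ∀ {ρ} → Injective _≡_ _≡_ ρ → ∀ c k P →
               fires c (ρ k) (renQ ρ P) ≡ fires (c ∘ renQ ρ) k P
  fires-renQ ρ-inj c k (sum M)     = firesS-renQS ρ-inj c k M
  fires-renQ ρ-inj c k (P ∣ Q)     = cong₂ _++_ (fires-renQ ρ-inj _ k P) (fires-renQ ρ-inj _ k Q)
  fires-renQ ρ-inj c k (ν P)       = fires-renQ ρ-inj (c ∘ ν_) k P
  fires-renQ ρ-inj c k (νq r P)    = fires-renQ (lift-injective ρ-inj) (c ∘ νq r) (suc k) P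
  fires-renQ ρ-inj c k (call A ys) = refl

  firesS-renQS-∉ : ∀ {ρ k} → (∀ j → ρ j ≢ k) → ∀ c M → firesS c k (renQS ρ M) ≡ []
  firesS-renQS-∉ ρ∉ c 𝟘           = refl
  firesS-renQS-∉ ρ∉ c (out x y P) = refl
  firesS-renQS-∉ ρ∉ c (inp x P)   = refl
  firesS-renQS-∉ ρ∉ c (tau P)     = refl
  firesS-renQS-∉ ρ∉ c (rate r P)  = refl
  firesS-renQS-∉ {ρ} {k} ρ∉ c (sto q P) with ρ q ≟ k
  ... | yes ρq≡k = ⊥-elim (ρ∉ q ρq≡k)
  ... | no  _    = refl
  firesS-renQS-∉ ρ∉ c (M ⊕ N) = cong₂ _++_ (firesS-renQS-∉ ρ∉ c M) (firesS-renQS-∉ ρ∉ c N)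

  fires-renQ-∉ : ∀ {ρ k} → (∀ j → ρ j ≢ k) → ∀ c P → fires c k (renQ ρ P) ≡ []
  fires-renQ-∉ ρ∉ c (sum M)     = firesS-renQS-∉ ρ∉ c M
  fires-renQ-∉ ρ∉ c (P ∣ Q)     = cong₂ _++_ (fires-renQ-∉ ρ∉ _ P) (fires-renQ-∉ ρ∉ _ Q)
  fires-renQ-∉ ρ∉ c (ν P)       = fires-renQ-∉ ρ∉ (c ∘ ν_) P
  fires-renQ-∉ ρ∉ c (νq r P)    = fires-renQ-∉ (lift-∉ ρ∉) (c ∘ νq r) P
  fires-renQ-∉ ρ∉ c (call A ys) = refl

  firesS-InPS : ∀ c k M → InPS M → firesS c k M ≡ []
  firesS-InPS c k 𝟘           _ = refl
  firesS-InPS c k (out x y P) _ = refl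
  firesS-InPS c k (inp x P)   _ = refl
  firesS-InPS c k (tau P)     _ = refl
  firesS-InPS c k (rate r P)  _ = refl
  firesS-InPS c k (M ⊕ N) (inM , inN) = cong₂ _++_ (firesS-InPS c k M inM) (firesS-InPS c k N inN)

  fires-InP : ∀ c k P → InP P → fires c k P ≡ []
  fires-InP c k (sum M)     inM         = firesS-InPS c k M inM
  fires-InP c k (P ∣ Q)     (inP , inQ) = cong₂ _++_ (fires-InP _ k P inP) (fires-InP _ k Q inQ)
  fires-InP c k (ν P)       inP         = fires-InP (c ∘ ν_) k P inP
  fires-InP c k (call A ys) _           = refl

  ∈-firesS⇒summand : ∀ c k M {X} → X ∈ firesS c k M → ∃₂ λ P M′ → M ≈S sto k P ⊕ M′
  ∈-firesS⇒summand c k (sto q P) X∈ with q ≟ k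
  ∈-firesS⇒summand c k (sto q P) X∈ | yes refl = P , 𝟘 , symS sum-𝟘
  ∈-firesS⇒summand c k (sto q P) () | no  _
  ∈-firesS⇒summand c k (M ⊕ N) X∈ with ∈-++⁻ (firesS c k M) X∈
  ... | inj₁ X∈M = let P , M′ , M≈ = ∈-firesS⇒summand c k M X∈M in P , M′ ⊕ N , ⊕-pullˡ M≈
  ... | inj₂ X∈N = let P , N′ , N≈ = ∈-firesS⇒summand c k N X∈N in P , N′ ⊕ M , ⊕-pullʳ N≈

  ∈-fires⇒step : ∀ c k P {X} → X ∈ fires c k P → ∃ (P ─[ just k ]→_)
  ∈-fires⇒step c k (sum M) X∈ =
    let P , M′ , M≈ = ∈-firesS⇒summand c k M X∈ in P , t-cong (c-sum M≈) t-sto reflP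
  ∈-fires⇒step c k (P ∣ Q) X∈ with ∈-++⁻ (fires _ k P) X∈
  ... | inj₁ X∈P = let P′ , t = ∈-fires⇒step _ k P X∈P in P′ ∣ Q , t-par t
  ... | inj₂ X∈Q =
    let Q′ , t = ∈-fires⇒step _ k Q X∈Q in P ∣ Q′ , t-cong par-comm (t-par t) par-comm
  ∈-fires⇒step c k (ν P) X∈ = let P′ , t = ∈-fires⇒step _ k P X∈ in ν P′ , t-ν t
  ∈-fires⇒step c k (νq r P) X∈ = let P′ , t = ∈-fires⇒step _ (suc k) P X∈ in νq r P′ , t-νq t

  module _ where
    open Permutation ≈P-setoid using (_↭_; prep; ↭-refl; ↭-sym; ↭-trans; ↭-reflexive)
    open PermutationProperties ≈P-setoid using (++⁺)

    firesS-≈ᶜ : ∀ {c c′} → c ≈ᶜ c′ → ∀ k M → firesS c k M ↭ firesS c′ k M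
    firesS-≈ᶜ c≈c′ k 𝟘           = ↭-refl
    firesS-≈ᶜ c≈c′ k (out x y P) = ↭-refl
    firesS-≈ᶜ c≈c′ k (inp x P)   = ↭-refl
    firesS-≈ᶜ c≈c′ k (tau P)     = ↭-refl
    firesS-≈ᶜ c≈c′ k (rate r P)  = ↭-refl
    firesS-≈ᶜ c≈c′ k (sto q P) with q ≟ k
    ... | yes _ = prep (c≈c′ reflP) ↭-refl
    ... | no  _ = ↭-refl
    firesS-≈ᶜ c≈c′ k (M ⊕ N)     = ++⁺ (firesS-≈ᶜ c≈c′ k M) (firesS-≈ᶜ c≈c′ k N)

    fires-≈ᶜ : ∀ {c c′} → c ≈ᶜ c′ → ∀ k P → fires c k P ↭ fires c′ k P
    fires-≈ᶜ c≈c′ k (sum M)     = firesS-≈ᶜ c≈c′ k M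
    fires-≈ᶜ c≈c′ k (P ∣ Q)     = ++⁺ (fires-≈ᶜ (λ X≈Y → c≈c′ (c-par X≈Y reflP)) k P)
                                      (fires-≈ᶜ (λ X≈Y → c≈c′ (c-par reflP X≈Y)) k Q)
    fires-≈ᶜ c≈c′ k (ν P)       = fires-≈ᶜ (c≈c′ ∘ c-ν) k P
    fires-≈ᶜ c≈c′ k (νq r P)    = fires-≈ᶜ (c≈c′ ∘ c-νq) (suc k) P
    fires-≈ᶜ c≈c′ k (call A ys) = ↭-refl

    fires-≈ᶜ-renC : ∀ {c c′} ρ → c ≈ᶜ c′ ∘ renC ρ → ∀ k P →
                    fires c k P ↭ fires c′ k (renC ρ P)
    fires-≈ᶜ-renC ρ c≈c′ k P =
      ↭-trans (fires-≈ᶜ c≈c′ k P) (↭-reflexive (sym (fires-renC _ ρ k P)))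

    fires-≈ᶜ-renQ : ∀ {c c′ ρ} → Injective _≡_ _≡_ ρ → c ≈ᶜ c′ ∘ renQ ρ → ∀ k P →
                    fires c k P ↭ fires c′ (ρ k) (renQ ρ P)
    fires-≈ᶜ-renQ ρ-inj c≈c′ k P =
      ↭-trans (fires-≈ᶜ c≈c′ k P) (↭-reflexive (sym (fires-renQ ρ-inj _ k P)))

  fires-extruded : ∀ c P Q → fires c 0 (P ∣ renQ suc Q) ≡ fires (λ X → c (X ∣ renQ suc Q)) 0 P
  fires-extruded c P Q =
    trans (cong (fires _ 0 P ++_) (fires-renQ-∉ (λ _ ()) _ Q)) (++-identityʳ (fires _ 0 P))

  ∈-fires-∘ : ∀ c k P {X} → X ∈ fires id k P → c X ∈ fires c k P
  ∈-fires-∘ c k P X∈ = subst (_ ∈_) (sym (fires-∘ c id k P)) (∈-map⁺ c X∈)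

  ∈-fires-∘⁻ : ∀ c k P {x} → x ∈ fires c k P → ∃ (_∈ fires id k P)
  ∈-fires-∘⁻ c k P x∈ =
    let X , X∈ , _ = ∈-map⁻ c (subst (_ ∈_) (fires-∘ c id k P) x∈) in X , X∈

  #fires-renC : ∀ ρ k P → #fires k (renC ρ P) ≡ #fires k P
  #fires-renC ρ k P = trans (cong length (fires-renC id ρ k P)) (length-fires (renC ρ) k P)

  #fires-renQ : ∀ {ρ} → Injective _≡_ _≡_ ρ → ∀ k P → #fires (ρ k) (renQ ρ P) ≡ #fires k P
  #fires-renQ {ρ} ρ-inj k P =
    trans (cong length (fires-renQ ρ-inj id k P)) (length-fires (renQ ρ) k P)

  -- Linear binders

  Linear : Proc → Set
  Linear (sum M)     = ⊤
  Linear (P ∣ Q)     = Linear P × Linear Q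
  Linear (ν P)       = Linear P
  Linear (νq r P)    = #fires 0 P ≤ 1 × Linear P
  Linear (call A ys) = ⊤

  InP⇒Linear : ∀ P → InP P → Linear P
  InP⇒Linear (sum M)     _           = tt
  InP⇒Linear (P ∣ Q)     (inP , inQ) = InP⇒Linear P inP , InP⇒Linear Q inQ
  InP⇒Linear (ν P)       inP         = InP⇒Linear P inP
  InP⇒Linear (call A ys) _           = tt

  Linear-renC : ∀ ρ P → Linear (renC ρ P) ⇔ Linear P
  Linear-renC ρ (sum M)     = ⇔-id _
  Linear-renC ρ (P ∣ Q)     = Linear-renC ρ P ×-⇔ Linear-renC ρ Q
  Linear-renC ρ (ν P)       = Linear-renC (lift ρ) P
  Linear-renC ρ (νq r P)    = ≤1-cong (#fires-renC ρ 0 P) ×-⇔ Linear-renC ρ P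
  Linear-renC ρ (call A ys) = ⇔-id _

  Linear-renQ : ∀ {ρ} → Injective _≡_ _≡_ ρ → ∀ P → Linear (renQ ρ P) ⇔ Linear P
  Linear-renQ ρ-inj (sum M)     = ⇔-id _
  Linear-renQ ρ-inj (P ∣ Q)     = Linear-renQ ρ-inj P ×-⇔ Linear-renQ ρ-inj Q
  Linear-renQ ρ-inj (ν P)       = Linear-renQ ρ-inj P
  Linear-renQ ρ-inj (νq r P)    =
    ≤1-cong (#fires-renQ (lift-injective ρ-inj) 0 P) ×-⇔ Linear-renQ (lift-injective ρ-inj) P
  Linear-renQ ρ-inj (call A ys) = ⇔-id _

  -- Candidate rate distributions

  Entry : Set
  Entry = Rate × Proc

  ≈E-setoid : Setoid _ _
  ≈E-setoid = record
    { Carrier = Entry ; _≈_ = _≈E_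
    ; isEquivalence = record
      { refl  = refl , reflP
      ; sym   = λ (r≡ , P≈) → sym r≡ , symP P≈
      ; trans = λ (r≡ , P≈) (r≡′ , P≈′) → trans r≡ r≡′ , transP P≈ P≈′ } }

  rates : (Proc → Proc) → Sum → List Entry
  rates c 𝟘           = []
  rates c (out x y P) = []
  rates c (inp x P)   = []
  rates c (tau P)     = []
  rates c (rate r P)  = (r , c P) ∷ []
  rates c (sto q P)   = []
  rates c (M ⊕ N)     = rates c M ++ rates c N

  rates-renCS : ∀ c ρ M → rates c (renCS ρ M) ≡ rates (c ∘ renC ρ) M
  rates-renCS c ρ 𝟘           = refl
  rates-renCS c ρ (out x y P) = refl
  rates-renCS c ρ (inp x P)   = refl
  rates-renCS c ρ (tau P)     = refl
  rates-renCS c ρ (rate r P)  = refl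
  rates-renCS c ρ (sto q P)   = refl
  rates-renCS c ρ (M ⊕ N)     = cong₂ _++_ (rates-renCS c ρ M) (rates-renCS c ρ N)

  rates-renQS : ∀ c ρ M → rates c (renQS ρ M) ≡ rates (c ∘ renQ ρ) M
  rates-renQS c ρ 𝟘           = refl
  rates-renQS c ρ (out x y P) = refl
  rates-renQS c ρ (inp x P)   = refl
  rates-renQS c ρ (tau P)     = refl
  rates-renQS c ρ (rate r P)  = refl
  rates-renQS c ρ (sto q P)   = refl
  rates-renQS c ρ (M ⊕ N)     = cong₂ _++_ (rates-renQS c ρ M) (rates-renQS c ρ N)

  ∈-rates⇒summand : ∀ c M {e} → e ∈ rates c M → ∃₂ λ r P → ∃ λ M′ → M ≈S rate r P ⊕ M′
  ∈-rates⇒summand c (rate r P) (here _) = r , P , 𝟘 , symS sum-𝟘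
  ∈-rates⇒summand c (M ⊕ N) e∈ with ∈-++⁻ (rates c M) e∈
  ... | inj₁ e∈M = let r , P , M′ , M≈ = ∈-rates⇒summand c M e∈M in r , P , M′ ⊕ N , ⊕-pullˡ M≈
  ... | inj₂ e∈N = let r , P , N′ , N≈ = ∈-rates⇒summand c N e∈N in r , P , N′ ⊕ M , ⊕-pullʳ N≈

  -- A relation rather than a function: constants have to be unfolded, which terminates only by
  -- weak guardedness (see moves-total).
  data Moves : (Proc → Proc) → Proc → List Entry → Set where
    mv-sum  : ∀ {c M} → Moves c (sum M) (rates c M)
    mv-par  : ∀ {c P Q l₁ l₂} → Moves (λ X → c (X ∣ Q)) P l₁ → Moves (λ X → c (P ∣ X)) Q l₂ →
              Moves c (P ∣ Q) (l₁ ++ l₂)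
    mv-ν    : ∀ {c P l} → Moves (c ∘ ν_) P l → Moves c (ν P) l
    mv-νq   : ∀ {c r P l} → Moves (c ∘ νq r) P l →
              Moves c (νq r P) (map (r ,_) (fires (c ∘ νq r) 0 P) ++ l)
    mv-call : ∀ {c A ys l} → Moves c (inst A ys) l → Moves c (call A ys) l

  moves-recontext : ∀ {c P l} → Moves c P l → ∀ c′ → ∃ (Moves c′ P)
  moves-recontext mv-sum         c′ = _ , mv-sum
  moves-recontext (mv-par d₁ d₂) c′ =
    _ , mv-par (proj₂ (moves-recontext d₁ _)) (proj₂ (moves-recontext d₂ _))
  moves-recontext (mv-ν d)       c′ = _ , mv-ν (proj₂ (moves-recontext d _))
  moves-recontext (mv-νq d)      c′ = _ , mv-νq (proj₂ (moves-recontext d _))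
  moves-recontext (mv-call d)    c′ = _ , mv-call (proj₂ (moves-recontext d c′))

  moves-functional : ∀ {c P l l′} → Moves c P l → Moves c P l′ → l ≡ l′
  moves-functional mv-sum         mv-sum           = refl
  moves-functional (mv-par d₁ d₂) (mv-par d₁′ d₂′) =
    cong₂ _++_ (moves-functional d₁ d₁′) (moves-functional d₂ d₂′)
  moves-functional (mv-ν d)       (mv-ν d′)        = moves-functional d d′
  moves-functional (mv-νq d)      (mv-νq d′)       = cong (_ ++_) (moves-functional d d′)
  moves-functional (mv-call d)    (mv-call d′)     = moves-functional d d′

  module _ where
    open Permutation ≈E-setoid using (_↭_; prep; ↭-refl; ↭-sym; ↭-trans; ↭-reflexive)
    open PermutationProperties ≈E-setoid using (++⁺)

    entries-↭ : ∀ {r xs ys} → Permutation._↭_ ≈P-setoid xs ys → map (r ,_) xs ↭ map (r ,_) ys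
    entries-↭ = PermutationProperties.map⁺ ≈P-setoid ≈E-setoid (refl ,_)

    rates-≈ᶜ : ∀ {c c′} → c ≈ᶜ c′ → ∀ M → rates c M ↭ rates c′ M
    rates-≈ᶜ c≈c′ 𝟘           = ↭-refl
    rates-≈ᶜ c≈c′ (out x y P) = ↭-refl
    rates-≈ᶜ c≈c′ (inp x P)   = ↭-refl
    rates-≈ᶜ c≈c′ (tau P)     = ↭-refl
    rates-≈ᶜ c≈c′ (rate r P)  = prep (refl , c≈c′ reflP) ↭-refl
    rates-≈ᶜ c≈c′ (sto q P)   = ↭-refl
    rates-≈ᶜ c≈c′ (M ⊕ N)     = ++⁺ (rates-≈ᶜ c≈c′ M) (rates-≈ᶜ c≈c′ N)

    moves-≈ᶜ : ∀ {c c′ P l l′} → c ≈ᶜ c′ → Moves c P l → Moves c′ P l′ → l ↭ l′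
    moves-≈ᶜ {P = sum M} c≈c′ mv-sum mv-sum = rates-≈ᶜ c≈c′ M
    moves-≈ᶜ c≈c′ (mv-par d₁ d₂) (mv-par d₁′ d₂′) =
      ++⁺ (moves-≈ᶜ (λ x → c≈c′ (c-par x reflP)) d₁ d₁′)
          (moves-≈ᶜ (λ x → c≈c′ (c-par reflP x)) d₂ d₂′)
    moves-≈ᶜ c≈c′ (mv-ν d)    (mv-ν d′)    = moves-≈ᶜ (c≈c′ ∘ c-ν) d d′
    moves-≈ᶜ {P = νq r P} c≈c′ (mv-νq d) (mv-νq d′) =
      ++⁺ (entries-↭ (fires-≈ᶜ (c≈c′ ∘ c-νq) 0 P)) (moves-≈ᶜ (c≈c′ ∘ c-νq) d d′)
    moves-≈ᶜ c≈c′ (mv-call d) (mv-call d′) = moves-≈ᶜ c≈c′ d d′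

  FiringBinder : Proc → Set
  FiringBinder Y = ∃₂ λ r Z → Y ≈P νq r Z × ∃ (_∈ fires id 0 Z)

  moves⇒firingBinder : ∀ {c Y l e} → Moves c Y l → e ∈ l → FiringBinder Y
  moves⇒firingBinder (mv-sum {M = M}) e∈ =
    let r , P , M′ , M≈ = ∈-rates⇒summand _ M e∈
    in r , _ , transP (c-sum M≈) rate-ν , renQ suc P , here refl
  moves⇒firingBinder (mv-par {P = P} {Q} {l₁} d₁ d₂) e∈ with ∈-++⁻ l₁ e∈
  ... | inj₁ e∈₁ = let r , Z , P≈ , X , X∈ = moves⇒firingBinder d₁ e∈₁
                   in r , Z ∣ renQ suc Q , transP (c-par P≈ reflP) extr-νq ,
                      X ∣ renQ suc Q , ++⁺ˡ (∈-fires-∘ _ 0 Z X∈)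
  ... | inj₂ e∈₂ = let r , Z , Q≈ , X , X∈ = moves⇒firingBinder d₂ e∈₂
                   in r , Z ∣ renQ suc P , transP par-comm (transP (c-par Q≈ reflP) extr-νq) ,
                      X ∣ renQ suc P , ++⁺ˡ (∈-fires-∘ _ 0 Z X∈)
  moves⇒firingBinder (mv-ν d) e∈ =
    let r , Z , P≈ , X , X∈ = moves⇒firingBinder d e∈
    in r , ν Z , transP (c-ν P≈) sw-ννq , ν X , ∈-fires-∘ ν_ 0 Z X∈
  moves⇒firingBinder (mv-νq {c} {r} {P} d) e∈ with ∈-++⁻ (map (r ,_) (fires (c ∘ νq r) 0 P)) e∈
  ... | inj₁ e∈F = let _ , x∈ , _ = ∈-map⁻ (r ,_) e∈F in r , P , reflP , ∈-fires-∘⁻ _ 0 P x∈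
  ... | inj₂ e∈l =
    let r′ , Z , P≈ , X , X∈ = moves⇒firingBinder d e∈l
    in r′ , νq r (renQ swap01 Z) , transP (c-νq P≈) sw-νqνq , νq r (renQ swap01 X) ,
       subst (νq r (renQ swap01 X) ∈_) (sym (fires-renQ swap01-injective (νq r) 0 Z))
         (∈-fires-∘ (νq r ∘ renQ swap01) 0 Z X∈)
  moves⇒firingBinder (mv-call d) e∈ =
    let r , Z , P≈ , X∈ = moves⇒firingBinder d e∈ in r , Z , transP unfold P≈ , X∈

  module WellFormed (wf : WellFormedDefs) where

    InP-inst : ∀ A ys → InP (inst A ys)
    InP-inst A ys = InP-renC (substArgs ys) (body A) (proj₁ (wf A))

    renC-inst : ∀ ρ A ys → renC ρ (inst A ys) ≡ inst A (Vec.map ρ ys)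
    renC-inst ρ A ys = renC-renC (substArgs-map ρ ys) (body A) (proj₁ (proj₂ (wf A)))

    moves-renC : ∀ c ρ {P l} → Moves (c ∘ renC ρ) P l → Moves c (renC ρ P) l
    moves-renC c ρ (mv-sum {M = M}) = subst (Moves c _) (rates-renCS c ρ M) mv-sum
    moves-renC c ρ (mv-par {P = P} {Q} d₁ d₂) =
      mv-par (moves-renC (λ X → c (X ∣ renC ρ Q)) ρ d₁)
             (moves-renC (λ X → c (renC ρ P ∣ X)) ρ d₂)
    moves-renC c ρ (mv-ν d) = mv-ν (moves-renC (c ∘ ν_) (lift ρ) d)
    moves-renC c ρ (mv-νq {r = r} {P} d) =
      subst (Moves c _) (cong (λ xs → map (r ,_) xs ++ _) (fires-renC (c ∘ νq r) ρ 0 P))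
        (mv-νq (moves-renC (c ∘ νq r) ρ d))
    moves-renC c ρ (mv-call {A = A} {ys} d) =
      mv-call (subst (λ Q → Moves c Q _) (renC-inst ρ A ys) (moves-renC c ρ d))

    moves-renQ : ∀ c {ρ} → Injective _≡_ _≡_ ρ → ∀ {P l} →
                 Moves (c ∘ renQ ρ) P l → Moves c (renQ ρ P) l
    moves-renQ c {ρ} ρ-inj (mv-sum {M = M}) = subst (Moves c _) (rates-renQS c ρ M) mv-sum
    moves-renQ c ρ-inj (mv-par {P = P} {Q} d₁ d₂) =
      mv-par (moves-renQ (λ X → c (X ∣ renQ _ Q)) ρ-inj d₁)
             (moves-renQ (λ X → c (renQ _ P ∣ X)) ρ-inj d₂)
    moves-renQ c ρ-inj (mv-ν d) = mv-ν (moves-renQ (c ∘ ν_) ρ-inj d)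
    moves-renQ c ρ-inj (mv-νq {r = r} {P} d) =
      subst (Moves c _)
        (cong (λ xs → map (r ,_) xs ++ _) (fires-renQ (lift-injective ρ-inj) (c ∘ νq r) 0 P))
        (mv-νq (moves-renQ (c ∘ νq r) (lift-injective ρ-inj) d))
    moves-renQ c {ρ} ρ-inj (mv-call {A = A} {ys} d) =
      mv-call (subst (λ Q → Moves c Q _) (renQ-InP ρ (inst A ys) (InP-inst A ys))
                     (moves-renQ c ρ-inj d))

    guarded-moves : ∀ c T → Guarded T → ∃ (Moves c T)
    guarded-moves c (sum M)  _ = _ , mv-sum
    guarded-moves c (P ∣ Q)  (gP , gQ) =
      _ , mv-par (proj₂ (guarded-moves _ P gP)) (proj₂ (guarded-moves _ Q gQ))
    guarded-moves c (ν P)    g = _ , mv-ν (proj₂ (guarded-moves _ P g))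
    guarded-moves c (νq r P) g = _ , mv-νq (proj₂ (guarded-moves _ P g))

    unfold⁻-moves : ∀ {c P P′ l} → Unfold P P′ → Moves c P′ l → ∃ (Moves c P)
    unfold⁻-moves u-here     d              = _ , mv-call d
    unfold⁻-moves (u-sum _)  _              = _ , mv-sum
    unfold⁻-moves (u-parˡ u) (mv-par d₁ d₂) =
      _ , mv-par (proj₂ (unfold⁻-moves u d₁)) (proj₂ (moves-recontext d₂ _))
    unfold⁻-moves (u-parʳ u) (mv-par d₁ d₂) =
      _ , mv-par (proj₂ (moves-recontext d₁ _)) (proj₂ (unfold⁻-moves u d₂))
    unfold⁻-moves (u-ν u)    (mv-ν d)       = _ , mv-ν (proj₂ (unfold⁻-moves u d))
    unfold⁻-moves (u-νq u)   (mv-νq d)      = _ , mv-νq (proj₂ (unfold⁻-moves u d))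

    unfolds⁻-moves : ∀ {c P T l} → Star Unfold P T → Moves c T l → ∃ (Moves c P)
    unfolds⁻-moves ε        d = _ , d
    unfolds⁻-moves (u ◅ us) d = unfold⁻-moves u (proj₂ (unfolds⁻-moves us d))

    moves-total : ∀ c P → ∃ (Moves c P)
    moves-total c (sum M)     = _ , mv-sum
    moves-total c (P ∣ Q)     = _ , mv-par (proj₂ (moves-total _ P)) (proj₂ (moves-total _ Q))
    moves-total c (ν P)       = _ , mv-ν (proj₂ (moves-total _ P))
    moves-total c (νq r P)    = _ , mv-νq (proj₂ (moves-total _ P))
    moves-total c (call A ys) =
      let T , body↠T , T-guarded = proj₂ (proj₂ (wf A))
          _ , dT    = guarded-moves (c ∘ renC (substArgs ys)) T T-guarded
          _ , dbody = unfolds⁻-moves body↠T dT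
      in _ , mv-call (moves-renC c (substArgs ys) dbody)

    -- Invariance under structural congruence

    module _ where
      open Permutation ≈P-setoid using (_↭_; prep; ↭-refl; ↭-sym; ↭-trans; ↭-reflexive)
      open PermutationProperties ≈P-setoid using (++⁺; ++-comm; Any-resp-↭; xs↭ys⇒|xs|≡|ys|)

      firesS-resp : ∀ {M N c c′ k} → M ≈S N → c ≈ᶜ c′ → firesS c k M ↭ firesS c′ k N
      firesS-resp {M} reflS c≈c′ = firesS-≈ᶜ c≈c′ _ M
      firesS-resp (symS e)     c≈c′ = ↭-sym (firesS-resp e (≈ᶜ-sym c≈c′))
      firesS-resp (transS e f) c≈c′ = ↭-trans (firesS-resp e (≈ᶜ-reflˡ c≈c′)) (firesS-resp f c≈c′)
      firesS-resp (c-out e)    c≈c′ = ↭-refl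
      firesS-resp (c-inp e)    c≈c′ = ↭-refl
      firesS-resp (c-tau e)    c≈c′ = ↭-refl
      firesS-resp (c-rate e)   c≈c′ = ↭-refl
      firesS-resp {k = k} (c-sto {q} e) c≈c′ with q ≟ k
      ... | yes _ = prep (c≈c′ e) ↭-refl
      ... | no  _ = ↭-refl
      firesS-resp (c-⊕ e f)    c≈c′ = ++⁺ (firesS-resp e c≈c′) (firesS-resp f c≈c′)
      firesS-resp {k = k} (sum-assoc {M₁} {M₂} {M₃}) c≈c′ =
        ↭-trans (↭-reflexive (++-assoc (firesS _ k M₁) _ _)) (firesS-≈ᶜ c≈c′ k (M₁ ⊕ M₂ ⊕ M₃))
      firesS-resp {k = k} (sum-comm {M} {N}) c≈c′ =
        ↭-trans (++-comm (firesS _ k M) _) (firesS-≈ᶜ c≈c′ k (N ⊕ M))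
      firesS-resp {k = k} (sum-𝟘 {M}) c≈c′ =
        ↭-trans (↭-reflexive (++-identityʳ _)) (firesS-≈ᶜ c≈c′ k M)

      fires-resp : ∀ {P Q c c′ k} → P ≈P Q → c ≈ᶜ c′ → fires c k P ↭ fires c′ k Q
      fires-resp {P} reflP c≈c′ = fires-≈ᶜ c≈c′ _ P
      fires-resp (symP e)     c≈c′ = ↭-sym (fires-resp e (≈ᶜ-sym c≈c′))
      fires-resp (transP e f) c≈c′ = ↭-trans (fires-resp e (≈ᶜ-reflˡ c≈c′)) (fires-resp f c≈c′)
      fires-resp (c-sum e)    c≈c′ = firesS-resp e c≈c′
      fires-resp (c-par e f)  c≈c′ =
        ++⁺ (fires-resp e (λ x → c≈c′ (c-par x f))) (fires-resp f (λ x → c≈c′ (c-par e x)))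
      fires-resp (c-ν e)      c≈c′ = fires-resp e (c≈c′ ∘ c-ν)
      fires-resp (c-νq e)     c≈c′ = fires-resp e (c≈c′ ∘ c-νq)
      fires-resp {k = k} (extr-ν {P} {Q}) c≈c′ =
        ++⁺ (fires-≈ᶜ (λ x → c≈c′ (transP (c-par (c-ν x) reflP) extr-ν)) k P)
            (fires-≈ᶜ-renC suc (λ x → c≈c′ (transP (c-par reflP x) extr-ν)) k Q)
      fires-resp {k = k} (extr-νq {P = P} {Q}) c≈c′ =
        ++⁺ (fires-≈ᶜ (λ x → c≈c′ (transP (c-par (c-νq x) reflP) extr-νq)) (suc k) P)
            (fires-≈ᶜ-renQ suc-injective (λ x → c≈c′ (transP (c-par reflP x) extr-νq)) k Q)
      fires-resp {k = k} (sw-νν {P}) c≈c′ =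
        fires-≈ᶜ-renC swap01 (λ x → c≈c′ (transP (c-ν (c-ν x)) sw-νν)) k P
      fires-resp {k = k} (sw-ννq {P = P}) c≈c′ =
        fires-≈ᶜ (λ x → c≈c′ (transP (c-ν (c-νq x)) sw-ννq)) (suc k) P
      fires-resp {k = k} (sw-νqνq {P = P}) c≈c′ =
        fires-≈ᶜ-renQ swap01-injective (λ x → c≈c′ (transP (c-νq (c-νq x)) sw-νqνq))
          (suc (suc k)) P
      fires-resp ν-𝟘          c≈c′ = ↭-refl
      fires-resp νq-𝟘         c≈c′ = ↭-refl
      fires-resp {k = k} (par-assoc {P} {Q} {R}) c≈c′ =
        ↭-trans (↭-reflexive (++-assoc (fires _ k P) _ _))
          (++⁺ (fires-≈ᶜ (λ x → c≈c′ (transP (c-par (c-par x reflP) reflP) par-assoc)) k P)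
          (++⁺ (fires-≈ᶜ (λ x → c≈c′ (transP (c-par (c-par reflP x) reflP) par-assoc)) k Q)
               (fires-≈ᶜ (λ x → c≈c′ (transP (c-par reflP x) par-assoc)) k R)))
      fires-resp {k = k} (par-comm {P} {Q}) c≈c′ =
        ↭-trans (++-comm (fires _ k P) _)
          (++⁺ (fires-≈ᶜ (λ x → c≈c′ (transP (c-par reflP x) par-comm)) k Q)
               (fires-≈ᶜ (λ x → c≈c′ (transP (c-par x reflP) par-comm)) k P))
      fires-resp {k = k} (par-𝟘 {P}) c≈c′ =
        ↭-trans (↭-reflexive (++-identityʳ _))
                (fires-≈ᶜ (λ x → c≈c′ (transP (c-par x reflP) par-𝟘)) k P)
      fires-resp {k = k} (unfold {A} {ys}) c≈c′ =
        ↭-reflexive (sym (fires-InP _ k (inst A ys) (InP-inst A ys)))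
      fires-resp {k = k} (rate-ν {P = P} {M}) c≈c′ =
        ↭-trans (firesS-≈ᶜ (λ x → c≈c′ (transP x (symP (νq-vacuous _)))) k M)
                (↭-reflexive (sym (firesS-renQS suc-injective _ k M)))

      step⇒fires : ∀ {c k P P′} → c ≈ᶜ c → P ─[ just k ]→ P′ → Any (c P′ ≈P_) (fires c k P)
      step⇒fires c≈c (t-sto {q}) with q ≟ q
      ... | yes _   = here reflP
      ... | no  q≢q = ⊥-elim (q≢q refl)
      step⇒fires c≈c (t-par t)  = ++⁺ˡ (step⇒fires (λ x → c≈c (c-par x reflP)) t)
      step⇒fires c≈c (t-ν t)    = step⇒fires (c≈c ∘ c-ν) t
      step⇒fires c≈c (t-νq t)   = step⇒fires (c≈c ∘ c-νq) t
      step⇒fires c≈c (t-cong P≈Q t Q′≈P′) =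
        Any-resp-↭ (λ y≈z x≈y → transP x≈y y≈z) (fires-resp (symP P≈Q) c≈c)
          (Any.map (transP (c≈c (symP Q′≈P′))) (step⇒fires c≈c t))

      Linear-resp : ∀ {P Q} → P ≈P Q → Linear P ⇔ Linear Q
      Linear-resp reflP        = ⇔-id _
      Linear-resp (symP e)     = ⇔-sym (Linear-resp e)
      Linear-resp (transP e f) = Linear-resp f ⇔-∘ Linear-resp e
      Linear-resp (c-sum e)    = ⇔-id _
      Linear-resp (c-par e f)  = Linear-resp e ×-⇔ Linear-resp f
      Linear-resp (c-ν e)      = Linear-resp e
      Linear-resp (c-νq e)     = ≤1-cong (xs↭ys⇒|xs|≡|ys| (fires-resp e id)) ×-⇔ Linear-resp e
      Linear-resp (extr-ν {Q = Q}) = ⇔-id _ ×-⇔ ⇔-sym (Linear-renC suc Q)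
      Linear-resp (extr-νq {P = P} {Q}) =
        (≤1-cong #fires-extruded ×-⇔ (⇔-id _ ×-⇔ ⇔-sym (Linear-renQ suc-injective Q))) ⇔-∘ ×-assocʳ
        where
          #fires-extruded : #fires 0 P ≡ #fires 0 (P ∣ renQ suc Q)
          #fires-extruded = sym (trans (cong length (fires-extruded id P Q)) (length-fires _ 0 P))
      Linear-resp (sw-νν {P}) = ⇔-sym (Linear-renC swap01 P)
      Linear-resp (sw-ννq {P = P}) = ≤1-cong (sym (length-fires ν_ 0 P)) ×-⇔ ⇔-id _
      Linear-resp (sw-νqνq {r} {r′} {P}) =
        (≤1-cong #fires-outer ×-⇔ (≤1-cong #fires-inner ×-⇔ ⇔-sym (Linear-renQ swap01-injective P)))
          ⇔-∘ ×-swapˡ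
        where
          #fires-outer : #fires 0 P ≡ #fires 0 (νq r (renQ swap01 P))
          #fires-outer =
            sym (trans (length-fires (νq r) 1 (renQ swap01 P)) (#fires-renQ swap01-injective 0 P))
          #fires-inner : #fires 0 (νq r′ P) ≡ #fires 0 (renQ swap01 P)
          #fires-inner = trans (length-fires (νq r′) 1 P) (sym (#fires-renQ swap01-injective 1 P))
      Linear-resp ν-𝟘          = ⇔-id _
      Linear-resp νq-𝟘         = mk⇔ (λ _ → tt) (λ _ → z≤n , tt)
      Linear-resp par-assoc    = ×-assocʳ
      Linear-resp par-comm     = mk⇔ (λ (a , b) → b , a) (λ (b , a) → a , b)
      Linear-resp par-𝟘        = mk⇔ proj₁ (_, tt)
      Linear-resp (unfold {A} {ys}) = mk⇔ (λ _ → InP⇒Linear (inst A ys) (InP-inst A ys)) (λ _ → tt)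
      Linear-resp (rate-ν {M = M}) =
        mk⇔ (λ _ → subst (λ xs → suc (length xs) ≤ 1) (sym (firesS-renQS-∉ (λ _ ()) id M)) (s≤s z≤n)
                 , tt)
            (λ _ → tt)

    module _ where
      open Permutation ≈E-setoid using (_↭_; prep; ↭-refl; ↭-sym; ↭-trans; ↭-reflexive)
      open PermutationProperties ≈E-setoid using (++⁺; ++-comm; shifts)

      moves-≈ᶜ-renC : ∀ {c c′ P l l′} ρ → c ≈ᶜ c′ ∘ renC ρ →
                      Moves c P l → Moves c′ (renC ρ P) l′ → l ↭ l′
      moves-≈ᶜ-renC {c′ = c′} {P} ρ c≈c′ d d′ =
        let _ , d″ = moves-total (c′ ∘ renC ρ) P
        in ↭-trans (moves-≈ᶜ c≈c′ d d″) (↭-reflexive (moves-functional (moves-renC c′ ρ d″) d′))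

      moves-≈ᶜ-renQ : ∀ {c c′ P l l′ ρ} → Injective _≡_ _≡_ ρ → c ≈ᶜ c′ ∘ renQ ρ →
                      Moves c P l → Moves c′ (renQ ρ P) l′ → l ↭ l′
      moves-≈ᶜ-renQ {c′ = c′} {P} {ρ = ρ} ρ-inj c≈c′ d d′ =
        let _ , d″ = moves-total (c′ ∘ renQ ρ) P
        in ↭-trans (moves-≈ᶜ c≈c′ d d″) (↭-reflexive (moves-functional (moves-renQ c′ ρ-inj d″) d′))

      rates-resp : ∀ {M N c c′} → M ≈S N → c ≈ᶜ c′ → rates c M ↭ rates c′ N
      rates-resp {M} reflS  c≈c′ = rates-≈ᶜ c≈c′ M
      rates-resp (symS e)     c≈c′ = ↭-sym (rates-resp e (≈ᶜ-sym c≈c′))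
      rates-resp (transS e f) c≈c′ = ↭-trans (rates-resp e (≈ᶜ-reflˡ c≈c′)) (rates-resp f c≈c′)
      rates-resp (c-out e)    c≈c′ = ↭-refl
      rates-resp (c-inp e)    c≈c′ = ↭-refl
      rates-resp (c-tau e)    c≈c′ = ↭-refl
      rates-resp (c-rate e)   c≈c′ = prep (refl , c≈c′ e) ↭-refl
      rates-resp (c-sto e)    c≈c′ = ↭-refl
      rates-resp (c-⊕ e f)    c≈c′ = ++⁺ (rates-resp e c≈c′) (rates-resp f c≈c′)
      rates-resp (sum-assoc {M₁} {M₂} {M₃}) c≈c′ =
        ↭-trans (↭-reflexive (++-assoc (rates _ M₁) _ _)) (rates-≈ᶜ c≈c′ (M₁ ⊕ M₂ ⊕ M₃))
      rates-resp (sum-comm {M} {N}) c≈c′ = ↭-trans (++-comm (rates _ M) _) (rates-≈ᶜ c≈c′ (N ⊕ M))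
      rates-resp (sum-𝟘 {M}) c≈c′ = ↭-trans (↭-reflexive (++-identityʳ _)) (rates-≈ᶜ c≈c′ M)

      moves-resp : ∀ {P Q c c′ l l′} → P ≈P Q → c ≈ᶜ c′ → Moves c P l → Moves c′ Q l′ → l ↭ l′
      moves-resp reflP        c≈c′ d d′ = moves-≈ᶜ c≈c′ d d′
      moves-resp (symP e)     c≈c′ d d′ = ↭-sym (moves-resp e (≈ᶜ-sym c≈c′) d′ d)
      moves-resp (transP {Q = Q} e f) c≈c′ d d′ =
        let _ , dQ = moves-total _ Q
        in ↭-trans (moves-resp e (≈ᶜ-reflˡ c≈c′) d dQ) (moves-resp f c≈c′ dQ d′)
      moves-resp (c-sum e)    c≈c′ mv-sum mv-sum = rates-resp e c≈c′
      moves-resp (c-par e f)  c≈c′ (mv-par d₁ d₂) (mv-par d₁′ d₂′) =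
        ++⁺ (moves-resp e (λ x → c≈c′ (c-par x f)) d₁ d₁′)
            (moves-resp f (λ x → c≈c′ (c-par e x)) d₂ d₂′)
      moves-resp (c-ν e)      c≈c′ (mv-ν d) (mv-ν d′) = moves-resp e (c≈c′ ∘ c-ν) d d′
      moves-resp (c-νq e)     c≈c′ (mv-νq d) (mv-νq d′) =
        ++⁺ (entries-↭ (fires-resp e (c≈c′ ∘ c-νq))) (moves-resp e (c≈c′ ∘ c-νq) d d′)
      moves-resp extr-ν       c≈c′ (mv-par (mv-ν d₁) d₂) (mv-ν (mv-par d₁′ d₂′)) =
        ++⁺ (moves-≈ᶜ (λ x → c≈c′ (transP (c-par (c-ν x) reflP) extr-ν)) d₁ d₁′)
            (moves-≈ᶜ-renC suc (λ x → c≈c′ (transP (c-par reflP x) extr-ν)) d₂ d₂′)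
      moves-resp {c = c} {c′} (extr-νq {r} {P} {Q}) c≈c′
                 (mv-par (mv-νq {l = l₁} d₁) d₂) (mv-νq (mv-par d₁′ d₂′)) =
        ↭-trans (↭-reflexive (++-assoc (map (r ,_) (fires _ 0 P)) l₁ _))
          (↭-trans (++⁺ (entries-↭ (fires-≈ᶜ extruded 0 P))
                   (++⁺ (moves-≈ᶜ extruded d₁ d₁′)
                        (moves-≈ᶜ-renQ suc-injective
                           (λ x → c≈c′ (transP (c-par reflP x) extr-νq)) d₂ d₂′)))
            (↭-reflexive (cong (λ xs → map (r ,_) xs ++ _) (sym (fires-extruded (c′ ∘ νq r) P Q)))))
        where
          extruded : (λ X → c (νq r X ∣ Q)) ≈ᶜ (λ X → c′ (νq r (X ∣ renQ suc Q)))
          extruded x = c≈c′ (transP (c-par (c-νq x) reflP) extr-νq)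
      moves-resp sw-νν c≈c′ (mv-ν (mv-ν d)) (mv-ν (mv-ν d′)) =
        moves-≈ᶜ-renC swap01 (λ x → c≈c′ (transP (c-ν (c-ν x)) sw-νν)) d d′
      moves-resp (sw-ννq {P = P}) c≈c′ (mv-ν (mv-νq d)) (mv-νq (mv-ν d′)) =
        ++⁺ (entries-↭ (fires-≈ᶜ (λ x → c≈c′ (transP (c-ν (c-νq x)) sw-ννq)) 0 P))
            (moves-≈ᶜ (λ x → c≈c′ (transP (c-ν (c-νq x)) sw-ννq)) d d′)
      moves-resp {c = c} {c′} (sw-νqνq {r} {r′} {P}) c≈c′
                 (mv-νq (mv-νq d)) (mv-νq (mv-νq d′)) =
        ↭-trans (shifts (map (r ,_) (fires _ 1 P)) (map (r′ ,_) (fires _ 0 P)))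
          (++⁺ (entries-↭ (fires-≈ᶜ-renQ swap01-injective swapped 0 P))
          (++⁺ (entries-↭ (fires-≈ᶜ-renQ swap01-injective swapped 1 P))
               (moves-≈ᶜ-renQ swap01-injective swapped d d′)))
        where
          swapped : (λ X → c (νq r (νq r′ X))) ≈ᶜ (λ X → c′ (νq r′ (νq r X))) ∘ renQ swap01
          swapped x = c≈c′ (transP (c-νq (c-νq x)) sw-νqνq)
      moves-resp ν-𝟘  c≈c′ (mv-ν mv-sum)  mv-sum = ↭-refl
      moves-resp νq-𝟘 c≈c′ (mv-νq mv-sum) mv-sum = ↭-refl
      moves-resp par-assoc c≈c′
                 (mv-par (mv-par {l₁ = l₁} d₁ d₂) d₃) (mv-par d₁′ (mv-par d₂′ d₃′)) =
        ↭-trans (↭-reflexive (++-assoc l₁ _ _))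
          (++⁺ (moves-≈ᶜ (λ x → c≈c′ (transP (c-par (c-par x reflP) reflP) par-assoc)) d₁ d₁′)
          (++⁺ (moves-≈ᶜ (λ x → c≈c′ (transP (c-par (c-par reflP x) reflP) par-assoc)) d₂ d₂′)
               (moves-≈ᶜ (λ x → c≈c′ (transP (c-par reflP x) par-assoc)) d₃ d₃′)))
      moves-resp par-comm c≈c′ (mv-par {l₁ = l₁} d₁ d₂) (mv-par d₂′ d₁′) =
        ↭-trans (++-comm l₁ _)
          (++⁺ (moves-≈ᶜ (λ x → c≈c′ (transP (c-par reflP x) par-comm)) d₂ d₂′)
               (moves-≈ᶜ (λ x → c≈c′ (transP (c-par x reflP) par-comm)) d₁ d₁′))
      moves-resp par-𝟘 c≈c′ (mv-par d₁ mv-sum) d′ =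
        ↭-trans (↭-reflexive (++-identityʳ _))
                (moves-≈ᶜ (λ x → c≈c′ (transP (c-par x reflP) par-𝟘)) d₁ d′)
      moves-resp unfold c≈c′ (mv-call d) d′ = moves-≈ᶜ c≈c′ d d′
      moves-resp {c′ = c′} (rate-ν {r} {P} {M}) c≈c′ mv-sum (mv-νq mv-sum) =
        prep (refl , c≈c′ (symP (νq-vacuous P)))
          (↭-trans (rates-≈ᶜ (λ x → c≈c′ (transP x (symP (νq-vacuous _)))) M)
                   (↭-reflexive (sym (trans
                     (cong (λ xs → map (r ,_) xs ++ rates (c′ ∘ νq r) (renQS suc M))
                           (firesS-renQS-∉ (λ _ ()) _ M))
                     (rates-renQS (c′ ∘ νq r) suc M)))))

    -- Stochastic transitions

    linear-fires-singleton : ∀ {c Y Y′} → c ≈ᶜ c → #fires 0 Y ≤ 1 → Y ─[ just 0 ]→ Y′ →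
                             ∃ λ W → fires c 0 Y ≡ W ∷ [] × c Y′ ≈P W
    linear-fires-singleton {c} {Y} c≈c #Y≤1 t =
      Any-singleton (step⇒fires c≈c t) (subst (_≤ 1) (sym (length-fires c 0 Y)) #Y≤1)

    firing-binder-shrinks : ∀ {c Z r Z′ X l l′} → c ≈ᶜ c → Z ≈P νq r Z′ → X ∈ fires id 0 Z′ →
                            Moves c Z l → Moves (c ∘ νq r) Z′ l′ → length l′ < length l
    firing-binder-shrinks {c} {r = r} {Z′} {l′ = l′} c≈c Z≈ X∈ dZ dZ′ =
      subst (length l′ <_) (sym (xs↭ys⇒|xs|≡|ys| (moves-resp Z≈ c≈c dZ (mv-νq dZ′))))
        (length-++-suffix _ l′ (∈-map⁺ (r ,_) (∈-fires-∘ (c ∘ νq r) 0 Z′ X∈)))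
      where open PermutationProperties ≈E-setoid using (xs↭ys⇒|xs|≡|ys|)

    module Stratified (N : Proc → Set) (stratified : StratifiedNeg N) where
      open Stochastic N
      open Permutation ≈E-setoid using (_↭_; prep; ↭-refl; ↭-sym; ↭-trans; ↭-reflexive)
      open PermutationProperties ≈E-setoid using (¬x∷xs↭[])

      ¬map++↭[] : ∀ {A : Set} {P : A → Set} {xs ys} {f : A → Entry} → Any P xs →
                  ¬ (map f xs ++ ys ↭ [])
      ¬map++↭[] (here _)  = ¬x∷xs↭[]
      ¬map++↭[] (there _) = ¬x∷xs↭[]

      ⟹⇒¬moves↭[] : ∀ {c P σ l} → c ≈ᶜ c → P ⟹ σ → Moves c P l → ¬ (l ↭ [])
      ⟹⇒¬moves↭[] c≈c (sto1 _ t) (mv-νq _) = ¬map++↭[] (step⇒fires (c≈c ∘ c-νq) t)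
      ⟹⇒¬moves↭[] c≈c (sto2 _ t) (mv-νq _) = ¬map++↭[] (step⇒fires (c≈c ∘ c-νq) t)
      ⟹⇒¬moves↭[] c≈c (stoCong {Q = Q} P≈Q d) dP l↭[] =
        let _ , dQ = moves-total _ Q
        in ⟹⇒¬moves↭[] c≈c d dQ (↭-trans (moves-resp (symP P≈Q) c≈c dQ dP) l↭[])

      -- Induction on the number of moves of Z: if there are none, Z has no stochastic transition
      -- and Sto2 applies; otherwise Z is ≡ a firing binder with fewer moves, and Sto1 applies.
      fires⇒νq⟹ : ∀ n {c r Z l X} → c ≈ᶜ c → Moves c Z l → length l < n → X ∈ fires id 0 Z →
                  ∃ (νq r Z ⟹_)
      fires⇒νq⟹ n {l = []} c≈c dZ _ X∈ =
        _ , sto2 (λ NZ → ⟹⇒¬moves↭[] c≈c (proj₂ (proj₁ (stratified _) NZ)) dZ ↭-refl)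
                 (proj₂ (∈-fires⇒step id 0 _ X∈))
      fires⇒νq⟹ (suc n) {c} {Z = Z} {_ ∷ _} c≈c dZ (s≤s l≤n) X∈ =
        let r′ , Z′ , Z≈ , X′ , X′∈ = moves⇒firingBinder dZ (here refl)
            _ , dZ′  = moves-total (c ∘ νq r′) Z′
            l′<n     = <-≤-trans (firing-binder-shrinks c≈c Z≈ X′∈ dZ dZ′) l≤n
            _ , Z′⟹ = fires⇒νq⟹ n (c≈c ∘ c-νq) dZ′ l′<n X′∈
        in _ , sto1 (stoCong Z≈ Z′⟹) (proj₂ (∈-fires⇒step id 0 Z X∈))

      moves⇒⟹ : ∀ {c Y l e} → Moves c Y l → e ∈ l → ∃ (Y ⟹_)
      moves⇒⟹ d e∈ =
        let r , Z , Y≈ , X , X∈ = moves⇒firingBinder d e∈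
            l , dZ = moves-total id Z
            σ , Z⟹ = fires⇒νq⟹ (suc (length l)) id dZ ≤-refl X∈
        in σ , stoCong Y≈ Z⟹

      ¬N⇒moves≡[] : ∀ {c Y l} → ¬ N Y → Moves c Y l → l ≡ []
      ¬N⇒moves≡[] {l = []}    ¬NY d = refl
      ¬N⇒moves≡[] {l = _ ∷ _} ¬NY d = ⊥-elim (¬NY (proj₂ (stratified _) (moves⇒⟹ d (here refl))))

      ⟹⇒↭moves : ∀ {c P σ l} → c ≈ᶜ c → Linear P → P ⟹ σ → Moves c P l →
                  map (map₂ c) (toList σ) ↭ l
      ⟹⇒↭moves c≈c linP (stoCong {Q = Q} P≈Q d) dP =
        let _ , dQ = moves-total _ Q
        in ↭-trans (⟹⇒↭moves c≈c (Equivalence.to (Linear-resp P≈Q) linP) d dQ)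
                   (moves-resp (symP P≈Q) c≈c dQ dP)
      ⟹⇒↭moves {c} c≈c (#Y≤1 , linY) (sto1 {r} {σ = σ} d t) (mv-νq {l = l} dY) =
        let W , F≡ , Y′≈W = linear-fires-singleton (c≈c ∘ c-νq) #Y≤1 t
            σ↭l = ⟹⇒↭moves (c≈c ∘ c-νq) linY d dY
            σ′↭l = ↭-trans (↭-reflexive (sym (map-∘ {g = map₂ c} (toList σ)))) σ↭l
        in ↭-trans (prep (refl , Y′≈W) σ′↭l)
                   (↭-reflexive (cong (λ xs → map (r ,_) xs ++ l) (sym F≡)))
      ⟹⇒↭moves c≈c (#Y≤1 , _) (sto2 {r} ¬NY t) (mv-νq dY) =
        let W , F≡ , Y′≈W = linear-fires-singleton (c≈c ∘ c-νq) #Y≤1 t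
        in ↭-trans (prep (refl , Y′≈W) ↭-refl)
                   (↭-reflexive (sym (cong₂ (λ xs l → map (r ,_) xs ++ l) F≡ (¬N⇒moves≡[] ¬NY dY))))

      uniqueness : ∀ P → InP P → ∀ {σ σ′} → P ⟹ σ → P ⟹ σ′ → σ ≈D σ′
      uniqueness P inP {σ} {σ′} d d′ =
        let _ , dP = moves-total id P
            linP   = InP⇒Linear P inP
            σ↭l    = ↭-trans (↭-reflexive (sym (map-id (toList σ)))) (⟹⇒↭moves id linP d dP)
            σ′↭l   = ↭-trans (↭-reflexive (sym (map-id (toList σ′)))) (⟹⇒↭moves id linP d′ dP)
        in ↭-trans σ↭l (↭-sym σ′↭l)

proposition8 : (Rate Const : Set) (arity : Const → ℕ)
    (body : Const → Syntax.Proc Rate Const arity) →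
    let open Semantics Rate Const arity body in
    WellFormedDefs →
    (N : Proc → Set) → StratifiedNeg N →
    (P : Proc) → InP P →
    (σ σ' : Dist) →
    Stochastic._⟹_ N P σ → Stochastic._⟹_ N P σ' → σ ≈D σ'
proposition8 Rate Const arity body wf N stratified P inP σ σ′ =
  Uniqueness.WellFormed.Stratified.uniqueness Rate Const arity body wf N stratified P inP
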